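{- Let $(V,\mathcal{E},\mathcal{B},k)$ be an instance of Subset-Test-$r$-Cover$(m-k)$ in which every vertex has degree at most $kr^2$, whose non-black edges have been colored as described below, and to which none of Rules 1, 2 and 3 applies. Let $x$ be a vertex contained in at least one edge. Then $x\in V(N_3[g])$ for some green edge $g$.
   Context: An edge $e$ of a hypergraph $(V,\mathcal{E})$ separates vertices $x,y$ if $|\{x,y\}\cap e|=1$; $\mathcal{T}\subseteq\mathcal{E}$ is a test cover if every pair of distinct vertices is separated by an edge of $\mathcal{T}$. The degree of a vertex is the number of edges containing it. An edge $e$ cuts a set $X$ if $X\cap e\ne\emptyset$ and $X\setminus e\neq\emptyset$. For $\mathcal{F}\subseteq\mathcal{E}$, $N_1(\mathcal{F})=\{e\in\mathcal{E}\setminus\mathcal{F}: \exists f\in\mathcal{F},\ f\cap e\neq\emptyset\}$, $N_1[\mathcal{F}]=N_1(\mathcal{F})\cup\mathcal{F}$, $N_j[\mathcal{F}]=N_1[N_{j-1}[\mathcal{F}]]$; for an edge $g$, $N_j[g]=N_j[\{g\}]$; for a set of edges $\mathcal{F}$, $V(\mathcal{F})$ is the set of vertices lying in some edge of $\mathcal{F}$. Subset-Test-$r$-Cover$(m-k)$: given a hypergraph $(V,\mathcal{E})$ with every edge of size at most $r$ and $\mathcal{E}$ a test cover, a subset $\mathcal{B}\subseteq\mathcal{E}$ of black edges required to be in the solution, and an integer $k$, decide whether there is a test cover $\mathcal{T}$ with $\mathcal{B}\subseteq\mathcal{T}\subseteq\mathcal{E}$ and $|\mathcal{T}|\le|\mathcal{E}|-k$.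 Rule 1: if $x$ is a vertex of degree $1$ and $b\in\mathcal{B}$ with $b=\{x\}$, delete $b$ and $x$, keep $k$. Rule 2: given $b\in\mathcal{B}$, if another edge $e$ satisfies $b\subsetneq e$, replace $e$ by $e\setminus b$; if some $b'\in\mathcal{B}$ is such that $b$ cuts $b'$ and $b'$ cuts $b$, replace $b,b'$ by black edges $b\setminus b'$, $b'\setminus b$, $b\cap b'$; keep $k$. Rule 3: given an orange edge $o$ such that $N_2[o]$ contains no green edge, delete $o$ and decrease $k$ by $1$. Coloring: each non-black edge $e$ with $\mathcal{E}\setminus\{e\}$ not a test cover is colored black (added to $\mathcal{B}$, with Rules 1 and 2 reapplied); a non-black edge $e$ with $\mathcal{E}\setminus\{e\}$ a test cover is colored orange if it contains a vertex of degree $1$, and green otherwise. -}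

module Defs where

open import Data.Nat using (ℕ; _≤_; _*_; _^_)
open import Data.Fin using (Fin)
open import Data.Fin.Subset using (Subset; _∈_; _∉_; _⊂_; ⁅_⁆; ∣_∣)
open import Data.Vec using (tabulate; lookup)
open import Data.Product using (Σ; ∃; ∃-syntax; _×_; _,_)
open import Data.Sum using (_⊎_)
open import Data.Unit using (⊤)
open import Relation.Nullary using (¬_)
open import Relation.Binary.PropositionalEquality using (_≡_; _≢_)

-- A hypergraph on vertex set Fin n with m (indexed) edges  E : Fin m → Subset n.
-- Sets of edges are represented as predicates on edge indices  Fin m → Set.

module _ {n m : ℕ} (E : Fin m → Subset n) where

  edgesAt : Fin n → Subset m
  edgesAt x = tabulate (λ i → lookup (E i) x)

  degree : Fin n → ℕ
  degree x = ∣ edgesAt x ∣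

  Separates : Subset n → Fin n → Fin n → Set
  Separates e x y = (x ∈ e × y ∉ e) ⊎ (y ∈ e × x ∉ e)

  IsTestCover : (Fin m → Set) → Set
  IsTestCover T = ∀ x y → x ≢ y → ∃[ i ] (T i × Separates (E i) x y)

  AllEdges : Fin m → Set
  AllEdges _ = ⊤

  AllBut : Fin m → Fin m → Set
  AllBut e i = i ≢ e

  Cuts : Subset n → Subset n → Set
  Cuts e X = (∃[ v ] (v ∈ X × v ∈ e)) × (∃[ v ] (v ∈ X × v ∉ e))

  Meets : Subset n → Subset n → Set
  Meets e f = ∃[ v ] (v ∈ e × v ∈ f)

  N1closed : (Fin m → Set) → (Fin m → Set)
  N1closed F e = F e ⊎ (¬ F e × ∃[ f ] (F f × Meets (E f) (E e)))

  -- Nb j F = N_j[F]  (Nb 0 F = F, Nb (j+1) F = N₁[Nb j F])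
  Nb : ℕ → (Fin m → Set) → (Fin m → Set)
  Nb ℕ.zero    F = F
  Nb (ℕ.suc j) F = N1closed (Nb j F)

  Single : Fin m → (Fin m → Set)
  Single g i = i ≡ g

  InV : (Fin m → Set) → Fin n → Set
  InV F x = ∃[ e ] (F e × x ∈ E e)

  module _ (B : Subset m) where

    Removable : Fin m → Set
    Removable e = e ∉ B × IsTestCover (AllBut e)

    Orange : Fin m → Set
    Orange e = Removable e × ∃[ v ] (v ∈ E e × degree v ≡ 1)

    Green : Fin m → Set
    Green e = Removable e × (∀ v → v ∈ E e → ¬ degree v ≡ 1)

    -- coloring done: every non-black edge is removable (otherwise it would be black)
    Colored : Set
    Colored = ∀ e → e ∉ B → IsTestCover (AllBut e)

    Rule1Applies : Set
    Rule1Applies = ∃[ x ] ∃[ b ] (degree x ≡ 1 × b ∈ B × E b ≡ ⁅ x ⁆)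

    Rule2Applies : Set
    Rule2Applies =
      (∃[ b ] ∃[ e ] (b ∈ B × e ≢ b × E b ⊂ E e))
      ⊎ (∃[ b ] ∃[ b′ ] (b ∈ B × b′ ∈ B × Cuts (E b) (E b′) × Cuts (E b′) (E b)))

    Rule3Applies : Set
    Rule3Applies = ∃[ o ] (Orange o × ¬ (∃[ g ] (Green g × Nb 2 (Single o) g)))

-- A non-black edge is
-- green, or orange and then (Rule 3 failing) within distance 2 of a green edge;
-- either way e ∈ N₂[g] ⊆ N₃[g]. If e is black and meets another edge f, then f
-- cannot be black (two distinct meeting black edges are nested or cut each
-- other, so Rule 2 would apply), hence f lies in some N₂[g] and e in N₃[g].
-- Finally a black edge meeting no other edge must be {x}, since only it could
-- separate x from its other vertices, and then x has degree 1, so Rule 1 would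
-- apply.
module Submission where

open import Defs
open import Data.Nat using (ℕ; zero; suc; _≤_; _*_; _^_) renaming (_≟_ to _ℕ-≟_)
open import Data.Fin using (Fin; _≟_)
open import Data.Fin.Properties using (any?; all?)
open import Data.Fin.Subset using (Subset; _∈_; _∉_; _⊈_; _⊂_; ⁅_⁆; ∣_∣)
open import Data.Fin.Subset.Properties
  using (_∈?_; _⊆?_; ⊆-antisym; x∈⁅x⁆; x∈⁅y⁆⇒x≡y; ∣⁅x⁆∣≡1)
open import Data.Vec using (lookup)
open import Data.Vec.Properties using ([]=⇒lookup; lookup⇒[]=; lookup∘tabulate)
open import Data.Product using (∃-syntax; _×_; _,_; proj₂)
open import Data.Sum using (_⊎_; inj₁; inj₂)
open import Function.Definitions using (Injective)
open import Relation.Nullary using (¬_; Dec; yes; no; contradiction)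
open import Relation.Nullary.Decidable using (_×-dec_; _→-dec_; ¬?; map′; decidable-stable)
open import Relation.Unary using (Pred; Decidable)
open import Relation.Binary.PropositionalEquality
  using (_≡_; _≢_; refl; sym; trans; cong; subst)

⊈⇒∃∉ : ∀ {n} {p q : Subset n} → p ⊈ q → ∃[ x ] (x ∈ p × x ∉ q)
⊈⇒∃∉ {p = p} {q} p⊈q = decidable-stable
  (any? (λ x → (x ∈? p) ×-dec ¬? (x ∈? q)))
  (λ ∄ → p⊈q λ {x} x∈p → decidable-stable (x ∈? q) (λ x∉q → ∄ (x , x∈p , x∉q)))

≡⁅⁆ : ∀ {n} {p : Subset n} {x} → x ∈ p → (∀ {y} → y ∈ p → y ≡ x) → p ≡ ⁅ x ⁆
≡⁅⁆ {p = p} {x} x∈p only-x = ⊆-antisym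
  (λ y∈p → subst (_∈ ⁅ x ⁆) (sym (only-x y∈p)) (x∈⁅x⁆ x))
  (λ y∈⁅x⁆ → subst (_∈ p) (sym (x∈⁅y⁆⇒x≡y x y∈⁅x⁆)) x∈p)

module _ {n m : ℕ} (E : Fin m → Subset n) where

  meets? : (p q : Subset n) → Dec (Meets E p q)
  meets? p q = any? (λ v → (v ∈? p) ×-dec (v ∈? q))

  meets-sym : ∀ {p q} → Meets E p q → Meets E q p
  meets-sym (v , v∈p , v∈q) = v , v∈q , v∈p

  ⊂-or-cuts : ∀ {p q} → p ≢ q → Meets E p q
            → p ⊂ q ⊎ q ⊂ p ⊎ (Cuts E p q × Cuts E q p)
  ⊂-or-cuts {p} {q} p≢q meet with p ⊆? q | q ⊆? p
  ... | yes p⊆q | yes q⊆p = contradiction (⊆-antisym p⊆q q⊆p) p≢q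
  ... | yes p⊆q | no  q⊈p = inj₁ (p⊆q , ⊈⇒∃∉ q⊈p)
  ... | no  p⊈q | yes q⊆p = inj₂ (inj₁ (q⊆p , ⊈⇒∃∉ p⊈q))
  ... | no  p⊈q | no  q⊈p =
    inj₂ (inj₂ ((meets-sym meet , ⊈⇒∃∉ q⊈p) , (meet , ⊈⇒∃∉ p⊈q)))

  ∈-edgesAt⁺ : ∀ {x i} → x ∈ E i → i ∈ edgesAt E x
  ∈-edgesAt⁺ {x} {i} x∈Ei = lookup⇒[]= i _
    (trans (lookup∘tabulate (λ j → lookup (E j) x) i) ([]=⇒lookup x∈Ei))

  ∈-edgesAt⁻ : ∀ {x i} → i ∈ edgesAt E x → x ∈ E i
  ∈-edgesAt⁻ {x} {i} i∈Ex = lookup⇒[]= x (E i)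
    (trans (sym (lookup∘tabulate (λ j → lookup (E j) x) i)) ([]=⇒lookup i∈Ex))

  Isolated : Fin m → Set
  Isolated b = ¬ (∃[ i ] (i ≢ b × Meets E (E b) (E i)))

  isolated⇒unique-edge : ∀ {x b i} → Isolated b → x ∈ E b → x ∈ E i → i ≡ b
  isolated⇒unique-edge {x} {b} {i} isolated x∈Eb x∈Ei =
    decidable-stable (i ≟ b) λ i≢b → isolated (i , i≢b , x , x∈Eb , x∈Ei)

  isolated⇒degree≡1 : ∀ {x b} → Isolated b → x ∈ E b → degree E x ≡ 1
  isolated⇒degree≡1 {x} {b} isolated x∈Eb = trans
    (cong ∣_∣ (≡⁅⁆ (∈-edgesAt⁺ x∈Eb)
      (λ i∈Ex → isolated⇒unique-edge isolated x∈Eb (∈-edgesAt⁻ i∈Ex))))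
    (∣⁅x⁆∣≡1 b)

  isolated⇒≡⁅⁆ : IsTestCover E (AllEdges E) → ∀ {x b} → Isolated b → x ∈ E b
               → E b ≡ ⁅ x ⁆
  isolated⇒≡⁅⁆ tc {x} {b} isolated x∈Eb = ≡⁅⁆ x∈Eb only-x
    where
    unseparated : ∀ {y i} → y ∈ E b → ¬ Separates E (E i) x y
    unseparated {y} {i} y∈Eb (inj₁ (x∈Ei , y∉Ei)) =
      y∉Ei (subst (λ j → y ∈ E j) (sym (isolated⇒unique-edge isolated x∈Eb x∈Ei)) y∈Eb)
    unseparated {y} {i} y∈Eb (inj₂ (y∈Ei , x∉Ei)) =
      x∉Ei (subst (λ j → x ∈ E j) (sym (isolated⇒unique-edge isolated y∈Eb y∈Ei)) x∈Eb)

    only-x : ∀ {y} → y ∈ E b → y ≡ x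
    only-x {y} y∈Eb = decidable-stable (y ≟ x) λ y≢x →
      let (_ , _ , sep) = tc x y (λ x≡y → y≢x (sym x≡y)) in unseparated y∈Eb sep

  N1closed? : ∀ {F : Pred (Fin m) _} → Decidable F → Decidable (N1closed E F)
  N1closed? F? e with F? e
  ... | yes Fe = yes (inj₁ Fe)
  ... | no ¬Fe with any? (λ f → F? f ×-dec meets? (E f) (E e))
  ...   | yes near = yes (inj₂ (¬Fe , near))
  ...   | no  far  = no λ { (inj₁ Fe) → ¬Fe Fe ; (inj₂ (_ , near)) → far near }

  Nb? : ∀ j {F : Pred (Fin m) _} → Decidable F → Decidable (Nb E j F)
  Nb? zero    F? = F?
  Nb? (suc j) F? = N1closed? (Nb? j F?)

  Nb-suc : ∀ j {F : Pred (Fin m) _} {e} → Nb E j F e → Nb E (suc j) F e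
  Nb-suc j = inj₁

  Nb-step : ∀ j {F : Pred (Fin m) _} → Decidable F → ∀ {f e}
          → Nb E j F f → Meets E (E f) (E e) → Nb E (suc j) F e
  Nb-step j F? {f} {e} Ff meet with Nb? j F? e
  ... | yes Fe = inj₁ Fe
  ... | no ¬Fe = inj₂ (¬Fe , f , Ff , meet)

  single? : ∀ g → Decidable (Single E g)
  single? g e = e ≟ g

  Nb-single-step : ∀ j {g f e}
                 → Nb E j (Single E g) f → Meets E (E f) (E e) → Nb E (suc j) (Single E g) e
  Nb-single-step j {g} = Nb-step j (single? g)

  Nb2-single-sym : ∀ {a c} → Nb E 2 (Single E a) c → Nb E 2 (Single E c) a
  Nb2-single-sym (inj₁ (inj₁ refl)) = Nb-suc 1 (Nb-suc 0 refl)
  Nb2-single-sym (inj₁ (inj₂ (_ , _ , refl , meet))) =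
    Nb-suc 1 (Nb-single-step 0 refl (meets-sym meet))
  Nb2-single-sym (inj₂ (_ , _ , inj₁ refl , meet)) =
    Nb-suc 1 (Nb-single-step 0 refl (meets-sym meet))
  Nb2-single-sym (inj₂ (_ , _ , inj₂ (_ , _ , refl , meet′) , meet)) =
    Nb-single-step 1 (Nb-single-step 0 refl (meets-sym meet)) (meets-sym meet′)

  module _ (B : Subset m) where

    has-degree-one-vertex? : ∀ e → Dec (∃[ v ] (v ∈ E e × degree E v ≡ 1))
    has-degree-one-vertex? e = any? (λ v → (v ∈? E e) ×-dec (degree E v ℕ-≟ 1))

    green? : Colored E B → Decidable (Green E B)
    green? col g with g ∈? B
    ... | yes g∈B = no λ { ((g∉B , _) , _) → g∉B g∈B }
    ... | no  g∉B = map′ ((g∉B , col g g∉B) ,_) proj₂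
      (all? (λ v → (v ∈? E g) →-dec ¬? (degree E v ℕ-≟ 1)))

    non-black⇒near-green : Colored E B → ¬ Rule3Applies E B
      → ∀ {e} → e ∉ B → ∃[ g ] (Green E B g × Nb E 2 (Single E g) e)
    non-black⇒near-green col ¬r3 {e} e∉B with has-degree-one-vertex? e
    ... | no ¬deg1 = e , ((e∉B , col e e∉B) , λ v v∈Ee deg1 → ¬deg1 (v , v∈Ee , deg1))
                       , Nb-suc 1 (Nb-suc 0 refl)
    ... | yes deg1 =
      let (g , green , near) = decidable-stable
            (any? (λ g → green? col g ×-dec Nb? 2 (single? e) g))
            (λ ∄ → ¬r3 (e , ((e∉B , col e e∉B) , deg1) , ∄))
      in g , green , Nb2-single-sym near

    meeting-black-edges⇒Rule2 : Injective _≡_ _≡_ E → ∀ {b e} → b ∈ B → e ∈ B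
      → e ≢ b → Meets E (E b) (E e) → Rule2Applies E B
    meeting-black-edges⇒Rule2 inj {b} {e} b∈B e∈B e≢b meet
      with ⊂-or-cuts (λ Eb≡Ee → e≢b (sym (inj Eb≡Ee))) meet
    ... | inj₁ Eb⊂Ee         = inj₁ (b , e , b∈B , e≢b , Eb⊂Ee)
    ... | inj₂ (inj₁ Ee⊂Eb)  = inj₁ (e , b , e∈B , (λ b≡e → e≢b (sym b≡e)) , Ee⊂Eb)
    ... | inj₂ (inj₂ cuts)   = inj₂ (b , e , b∈B , e∈B , cuts)

lemma15 : ∀ {n m : ℕ} (r k : ℕ) (E : Fin m → Subset n) (B : Subset m)
    → Injective _≡_ _≡_ E
    → (∀ e → ∣ E e ∣ ≤ r)
    → IsTestCover E (AllEdges E)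
    → (∀ v → degree E v ≤ k * r ^ 2)
    → Colored E B
    → ¬ Rule1Applies E B
    → ¬ Rule2Applies E B
    → ¬ Rule3Applies E B
    → (x : Fin n) → ∃[ e ] (x ∈ E e)
    → ∃[ g ] (Green E B g × InV E (Nb E 3 (Single E g)) x)
lemma15 _ _ E B inj _ tc _ col ¬r1 ¬r2 ¬r3 x (b , x∈Eb) with b ∈? B
... | no b∉B =
  let (g , green , near) = non-black⇒near-green E B col ¬r3 b∉B
  in g , green , b , Nb-suc E 2 near , x∈Eb
... | yes b∈B with any? (λ e → ¬? (e ≟ b) ×-dec meets? E (E b) (E e))
...   | no isolated = contradiction
  (x , b , isolated⇒degree≡1 E isolated x∈Eb , b∈B , isolated⇒≡⁅⁆ E tc isolated x∈Eb) ¬r1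
...   | yes (e , e≢b , meet) with e ∈? B
...     | yes e∈B = contradiction (meeting-black-edges⇒Rule2 E B inj b∈B e∈B e≢b meet) ¬r2
...     | no  e∉B =
  let (g , green , near) = non-black⇒near-green E B col ¬r3 e∉B
  in g , green , b , Nb-single-step E 2 near (meets-sym E meet) , x∈Eb
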